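{- Let $\ell,n$ be integers such that $p=4n-1$ is prime, and let \[A_{<}=\{k\in\{2,\dots,n+2\}: r_p((k-1)^2)<3n-k-1\},\qquad A_{[)}=\{k\in\{2,\dots,n+2\}: 3n-k-1\le r_p((k-1)^2)<3n+k-3\}.\] (a) If $\ell\ge 6$ and $n=4\ell+2$ or $n=4\ell+3$, then $n-3,n-1,n+1\in A_{[)}$ and $n-2,n,n+2\in A_{<}$. (b) If $\ell\ge 4$ and $n=4\ell+1$ or $n=4\ell+4$, then $n-3,n-1,n+1\in A_{<}$ and $n-2,n,n+2\in A_{[)}$.
   Context: For a positive integer $q$ and $x\in\mathbb{Z}$, $r_q(x)\in\{0,1,\dots,q-1\}$ denotes the remainder of $x$ upon division by $q$. -}

module Defs where

open import Data.Nat using (ℕ; zero; suc; _+_; _*_; _∸_; _^_; _≤_; _<_)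
open import Data.Nat.DivMod using (_%_)
open import Data.Product using (_×_)

-- r q x : remainder of x upon division by q (only meaningful for q > 0;
-- the value at q = 0 is an irrelevant convention, we only use q = p prime).
r : ℕ → ℕ → ℕ
r zero    x = x
r (suc q) x = x % suc q

p : ℕ → ℕ
p n = 4 * n ∸ 1

-- k ∈ A_< :  k ∈ {2,…,n+2}  and  r_p((k-1)^2) < 3n - k - 1
-- (the integer inequality  r < 3n-k-1  is written as  r + k + 1 < 3n)
A< : ℕ → ℕ → Set
A< n k = (2 ≤ k) × (k ≤ n + 2) × (r (p n) ((k ∸ 1) ^ 2) + k + 1 < 3 * n)

-- k ∈ A_[) :  k ∈ {2,…,n+2}  and  3n - k - 1 ≤ r_p((k-1)^2) < 3n + k - 3
-- (written as  3n ≤ r + k + 1  and  r + 3 < 3n + k)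
A≤< : ℕ → ℕ → Set
A≤< n k = (2 ≤ k) × (k ≤ n + 2)
        × (3 * n ≤ r (p n) ((k ∸ 1) ^ 2) + k + 1)
        × (r (p n) ((k ∸ 1) ^ 2) + 3 < 3 * n + k)

{-# OPTIONS --safe #-}
module Submission where

-- For n = 4ℓ + j and the lower bound ℓ₀ on ℓ, write n = c + 4m with c = 4ℓ₀ + j and m = ℓ − ℓ₀.
-- Then p = 4n − 1 = p(c) + 16m, and for each of the six k the number k − 1 = s + 4m satisfies
-- (k − 1)² = (ρ + σm) + (e + m)·p with constants s, e, ρ, σ and ρ + σm < p, so the residue is
-- affine in m. Every inequality defining A_< and A_[) then compares two affine functions of m;
-- it holds for all m as soon as it holds between the constant terms and between the slopes,
-- a finite check on numerals.

open import Defs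
open import Data.Nat using (ℕ; suc; _+_; _*_; _∸_; _^_; _≤_; _<_; _≤?_; _<?_)
open import Data.Nat.DivMod using ([m+kn]%n≡m%n; m<n⇒m%n≡m)
open import Data.Nat.Primality using (Prime)
open import Data.Nat.Properties
open import Data.Nat.Tactic.RingSolver using (solve)
open import Data.List using ([]; _∷_)
open import Data.Product using (_×_; _,_)
open import Data.Sum using (_⊎_; inj₁; inj₂)
open import Relation.Nullary.Decidable using (Dec; True; toWitness; _×-dec_)
open import Relation.Binary.PropositionalEquality
  using (_≡_; refl; cong; cong₂; sym; trans; subst; module ≡-Reasoning)

affine-mono-≤ : ∀ {a b c d} m → a ≤ c → b ≤ d → a + b * m ≤ c + d * m
affine-mono-≤ m a≤c b≤d = +-mono-≤ a≤c (*-monoˡ-≤ m b≤d)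

affine-mono-< : ∀ {a b c d} m → a < c → b ≤ d → a + b * m < c + d * m
affine-mono-< m a<c b≤d = +-mono-<-≤ a<c (*-monoˡ-≤ m b≤d)

r-by-division : ∀ {P x} R q → x ≡ R + q * P → R < P → r P x ≡ R
r-by-division {suc P} R q refl R<P = trans ([m+kn]%n≡m%n R q (suc P)) (m<n⇒m%n≡m R<P)

p[c+4m]≡p[c]+16m : ∀ {c} m → 1 ≤ c → p (c + 4 * m) ≡ p c + 16 * m
p[c+4m]≡p[c]+16m {c} m 1≤c = begin
  4 * (c + 4 * m) ∸ 1   ≡⟨ cong (_∸ 1) distrib ⟩
  (4 * c + 16 * m) ∸ 1  ≡⟨ +-∸-comm (16 * m) (≤-trans 1≤c (m≤n*m c 4)) ⟩
  p c + 16 * m          ∎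
  where
  open ≡-Reasoning
  distrib : 4 * (c + 4 * m) ≡ 4 * c + 16 * m
  distrib = solve (c ∷ m ∷ [])

square-division : ∀ {s t e ρ σ} m → ρ + e * t ≡ s * s → σ + (t + 16 * e) ≡ 8 * s →
                  (s + 4 * m) ^ 2 ≡ (ρ + σ * m) + (e + m) * (t + 16 * m)
square-division {s} {t} {e} {ρ} {σ} m ρ+et≡s² σ+t+16e≡8s = begin
  (s + 4 * m) ^ 2                                      ≡⟨⟩
  (s + 4 * m) * ((s + 4 * m) * 1)                      ≡⟨ solve (s ∷ m ∷ []) ⟩
  s * s + 8 * s * m + 16 * (m * m)                     ≡⟨ cong₂ (λ a b → a + b * m + 16 * (m * m))
                                                               (sym ρ+et≡s²) (sym σ+t+16e≡8s) ⟩
  (ρ + e * t) + (σ + (t + 16 * e)) * m + 16 * (m * m)  ≡⟨ solve (s ∷ t ∷ e ∷ ρ ∷ σ ∷ m ∷ []) ⟩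
  (ρ + σ * m) + (e + m) * (t + 16 * m)                 ∎
  where open ≡-Reasoning

in-window : ∀ {c s} m {Z : Set} → 2 ≤ 1 + s → 1 + s ≤ c + 2 → Z →
            2 ≤ 1 + s + 4 * m × 1 + s + 4 * m ≤ c + 4 * m + 2 × Z
in-window {c} {s} m 2≤1+s 1+s≤c+2 z =
    ≤-trans 2≤1+s (m≤m+n (1 + s) (4 * m))
  , (begin
      1 + s + 4 * m    ≤⟨ affine-mono-≤ m 1+s≤c+2 (≤-refl {4}) ⟩
      c + 2 + 4 * m    ≡⟨ solve (c ∷ m ∷ []) ⟩
      c + 4 * m + 2    ∎)
  , z
  where open ≤-Reasoning

affine-below-3n : ∀ {c s ρ σ} m → ρ + s + 2 < 3 * c → σ ≤ 8 →
                  (ρ + σ * m) + (1 + s + 4 * m) + 1 < 3 * (c + 4 * m)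
affine-below-3n {c} {s} {ρ} {σ} m ρ+s+2<3c σ≤8 = begin-strict
  (ρ + σ * m) + (1 + s + 4 * m) + 1  ≡⟨ solve (ρ ∷ σ ∷ s ∷ m ∷ []) ⟩
  (ρ + s + 2) + (σ + 4) * m          <⟨ affine-mono-< m ρ+s+2<3c (+-monoˡ-≤ 4 σ≤8) ⟩
  3 * c + 12 * m                     ≡⟨ solve (c ∷ m ∷ []) ⟩
  3 * (c + 4 * m)                    ∎
  where open ≤-Reasoning

affine-above-3n : ∀ {c s ρ σ} m → 3 * c ≤ ρ + s + 2 → 8 ≤ σ →
                  3 * (c + 4 * m) ≤ (ρ + σ * m) + (1 + s + 4 * m) + 1
affine-above-3n {c} {s} {ρ} {σ} m 3c≤ρ+s+2 8≤σ = begin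
  3 * (c + 4 * m)                    ≡⟨ solve (c ∷ m ∷ []) ⟩
  3 * c + 12 * m                     ≤⟨ affine-mono-≤ m 3c≤ρ+s+2 (+-monoˡ-≤ 4 8≤σ) ⟩
  (ρ + s + 2) + (σ + 4) * m          ≡⟨ solve (ρ ∷ σ ∷ s ∷ m ∷ []) ⟩
  (ρ + σ * m) + (1 + s + 4 * m) + 1  ∎
  where open ≤-Reasoning

affine-below-3n+k : ∀ {c s ρ σ} m → ρ + 3 < 3 * c + (1 + s) → σ ≤ 16 →
                    (ρ + σ * m) + 3 < 3 * (c + 4 * m) + (1 + s + 4 * m)
affine-below-3n+k {c} {s} {ρ} {σ} m ρ+3<3c+1+s σ≤16 = begin-strict
  (ρ + σ * m) + 3                    ≡⟨ solve (ρ ∷ σ ∷ m ∷ []) ⟩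
  (ρ + 3) + σ * m                    <⟨ affine-mono-< m ρ+3<3c+1+s σ≤16 ⟩
  (3 * c + (1 + s)) + 16 * m         ≡⟨ solve (c ∷ s ∷ m ∷ []) ⟩
  3 * (c + 4 * m) + (1 + s + 4 * m)  ∎
  where open ≤-Reasoning

-- n = c + 4m and k = 1 + s + 4m; the quotient of (k − 1)² by p n is e + m.
module AffineSquare (c s e : ℕ) where

  ρ σ : ℕ
  ρ = s * s ∸ e * p c
  σ = 8 * s ∸ (p c + 16 * e)

  quotient? : Dec (1 ≤ c × e * p c ≤ s * s × p c + 16 * e ≤ 8 * s × ρ < p c × σ ≤ 16)
  quotient? = 1 ≤? c ×-dec e * p c ≤? s * s ×-dec p c + 16 * e ≤? 8 * s ×-dec ρ <? p c ×-dec σ ≤? 16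

  residue : {_ : True quotient?} → ∀ m → r (p (c + 4 * m)) ((s + 4 * m) ^ 2) ≡ ρ + σ * m
  residue {q} m with toWitness q
  ... | 1≤c , ep≤s² , p+16e≤8s , ρ<p , σ≤16 = begin
    r (p (c + 4 * m)) ((s + 4 * m) ^ 2)  ≡⟨ cong (λ P → r P ((s + 4 * m) ^ 2)) (p[c+4m]≡p[c]+16m m 1≤c) ⟩
    r (p c + 16 * m) ((s + 4 * m) ^ 2)   ≡⟨ r-by-division (ρ + σ * m) (e + m)
                                              (square-division {s} {p c} {e} {ρ} {σ} m
                                                (m∸n+n≡m ep≤s²) (m∸n+n≡m p+16e≤8s))
                                              (affine-mono-< m ρ<p σ≤16) ⟩
    ρ + σ * m                            ∎
    where open ≡-Reasoning

  A<? : Dec (2 ≤ 1 + s × 1 + s ≤ c + 2 × ρ + s + 2 < 3 * c × σ ≤ 8)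
  A<? = 2 ≤? 1 + s ×-dec 1 + s ≤? c + 2 ×-dec ρ + s + 2 <? 3 * c ×-dec σ ≤? 8

  ∈A< : {q : True quotient?} {_ : True A<?} → ∀ m → A< (c + 4 * m) (1 + s + 4 * m)
  ∈A< {q} {a} m with toWitness a
  ... | 2≤k , k≤n+2 , ρ+s+2<3c , σ≤8 = in-window m 2≤k k≤n+2
    (subst (λ R → R + (1 + s + 4 * m) + 1 < 3 * (c + 4 * m)) (sym (residue {q} m))
      (affine-below-3n {c} {s} m ρ+s+2<3c σ≤8))

  A≤<? : Dec (2 ≤ 1 + s × 1 + s ≤ c + 2 × 3 * c ≤ ρ + s + 2 × 8 ≤ σ × ρ + 3 < 3 * c + (1 + s))
  A≤<? = 2 ≤? 1 + s ×-dec 1 + s ≤? c + 2 ×-dec 3 * c ≤? ρ + s + 2 ×-dec 8 ≤? σ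
         ×-dec ρ + 3 <? 3 * c + (1 + s)

  ∈A≤< : {q : True quotient?} {_ : True A≤<?} → ∀ m → A≤< (c + 4 * m) (1 + s + 4 * m)
  ∈A≤< {q} {a} m with toWitness q | toWitness a
  ... | _ , _ , _ , _ , σ≤16 | 2≤k , k≤n+2 , 3c≤ρ+s+2 , 8≤σ , ρ+3<3c+1+s = in-window m 2≤k k≤n+2
    ( subst (λ R → 3 * (c + 4 * m) ≤ R + (1 + s + 4 * m) + 1) (sym (residue {q} m))
        (affine-above-3n {c} {s} m 3c≤ρ+s+2 8≤σ)
    , subst (λ R → R + 3 < 3 * (c + 4 * m) + (1 + s + 4 * m)) (sym (residue {q} m))
        (affine-below-3n+k {c} {s} m ρ+3<3c+1+s σ≤16))

open AffineSquare using (∈A<; ∈A≤<)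

Alternating : (ℕ → ℕ → Set) → (ℕ → ℕ → Set) → ℕ → Set
Alternating X Y n = (X n (n ∸ 3) × X n (n ∸ 1) × X n (n + 1)) × (Y n (n ∸ 2) × Y n n × Y n (n + 2))

alternating : ∀ (X Y : ℕ → ℕ → Set) n → X n (n ∸ 3) → X n (n ∸ 1) → X n (1 + n) →
              Y n (n ∸ 2) → Y n n → Y n (2 + n) → Alternating X Y n
alternating X Y n x₋₃ x₋₁ x₁ y₋₂ y₀ y₂ =
  (x₋₃ , x₋₁ , subst (X n) (+-comm 1 n) x₁) , (y₋₂ , y₀ , subst (Y n) (+-comm 2 n) y₂)

alternating-26+4m : ∀ m → Alternating A≤< A< (26 + 4 * m)
alternating-26+4m m = alternating A≤< A< (26 + 4 * m)
  (∈A≤< 26 22 4 m) (∈A≤< 26 24 5 m) (∈A≤< 26 26 6 m) (∈A< 26 23 5 m) (∈A< 26 25 6 m) (∈A< 26 27 7 m)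

alternating-27+4m : ∀ m → Alternating A≤< A< (27 + 4 * m)
alternating-27+4m m = alternating A≤< A< (27 + 4 * m)
  (∈A≤< 27 23 4 m) (∈A≤< 27 25 5 m) (∈A≤< 27 27 6 m) (∈A< 27 24 5 m) (∈A< 27 26 6 m) (∈A< 27 28 7 m)

alternating-17+4m : ∀ m → Alternating A< A≤< (17 + 4 * m)
alternating-17+4m m = alternating A< A≤< (17 + 4 * m)
  (∈A< 17 13 2 m) (∈A< 17 15 3 m) (∈A< 17 17 4 m) (∈A≤< 17 14 2 m) (∈A≤< 17 16 3 m) (∈A≤< 17 18 4 m)

alternating-20+4m : ∀ m → Alternating A< A≤< (20 + 4 * m)
alternating-20+4m m = alternating A< A≤< (20 + 4 * m)
  (∈A< 20 16 3 m) (∈A< 20 18 4 m) (∈A< 20 20 5 m) (∈A≤< 20 17 3 m) (∈A≤< 20 19 4 m) (∈A≤< 20 21 5 m)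

4ℓ+c≡4ℓ₀+c+4[ℓ∸ℓ₀] : ∀ {ℓ₀ ℓ} c → ℓ₀ ≤ ℓ → 4 * ℓ + c ≡ (4 * ℓ₀ + c) + 4 * (ℓ ∸ ℓ₀)
4ℓ+c≡4ℓ₀+c+4[ℓ∸ℓ₀] {ℓ₀} {ℓ} c ℓ₀≤ℓ = begin
  4 * ℓ + c                    ≡⟨ cong (λ x → 4 * x + c) (m+[n∸m]≡n ℓ₀≤ℓ) ⟨
  4 * (ℓ₀ + (ℓ ∸ ℓ₀)) + c      ≡⟨ regroup ℓ₀ (ℓ ∸ ℓ₀) ⟩
  (4 * ℓ₀ + c) + 4 * (ℓ ∸ ℓ₀)  ∎
  where
  open ≡-Reasoning
  regroup : ∀ a b → 4 * (a + b) + c ≡ (4 * a + c) + 4 * b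
  regroup a b = solve (a ∷ b ∷ c ∷ [])

lemma3p2 : (ℓ n : ℕ) → Prime (4 * n ∸ 1) →
    ((6 ≤ ℓ → (n ≡ 4 * ℓ + 2) ⊎ (n ≡ 4 * ℓ + 3) →
        (A≤< n (n ∸ 3) × A≤< n (n ∸ 1) × A≤< n (n + 1))
      × (A< n (n ∸ 2) × A< n n × A< n (n + 2)))
    × (4 ≤ ℓ → (n ≡ 4 * ℓ + 1) ⊎ (n ≡ 4 * ℓ + 4) →
        (A< n (n ∸ 3) × A< n (n ∸ 1) × A< n (n + 1))
      × (A≤< n (n ∸ 2) × A≤< n n × A≤< n (n + 2))))
lemma3p2 ℓ n _ = part-a , part-b
  where
  from-base : ∀ X Y {ℓ₀} c → ℓ₀ ≤ ℓ → n ≡ 4 * ℓ + c →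
              Alternating X Y ((4 * ℓ₀ + c) + 4 * (ℓ ∸ ℓ₀)) → Alternating X Y n
  from-base X Y c ℓ₀≤ℓ n≡ = subst (Alternating X Y) (sym (trans n≡ (4ℓ+c≡4ℓ₀+c+4[ℓ∸ℓ₀] c ℓ₀≤ℓ)))

  part-a : 6 ≤ ℓ → (n ≡ 4 * ℓ + 2) ⊎ (n ≡ 4 * ℓ + 3) → Alternating A≤< A< n
  part-a 6≤ℓ (inj₁ n≡) = from-base A≤< A< 2 6≤ℓ n≡ (alternating-26+4m (ℓ ∸ 6))
  part-a 6≤ℓ (inj₂ n≡) = from-base A≤< A< 3 6≤ℓ n≡ (alternating-27+4m (ℓ ∸ 6))

  part-b : 4 ≤ ℓ → (n ≡ 4 * ℓ + 1) ⊎ (n ≡ 4 * ℓ + 4) → Alternating A< A≤< n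
  part-b 4≤ℓ (inj₁ n≡) = from-base A< A≤< 1 4≤ℓ n≡ (alternating-17+4m (ℓ ∸ 4))
  part-b 4≤ℓ (inj₂ n≡) = from-base A< A≤< 4 4≤ℓ n≡ (alternating-20+4m (ℓ ∸ 4))
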